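{- Let $N=(V,E_S\cup E_T)$ be a galled LGT network and let $v\in V$ be a node with two distinct descendants $x$ and $y$ in the support tree $\overline{N}$ that are transfer nodes ($v\in\{x,y\}$ is allowed). Then one of the transfer edges of $N$ incident to $x$ or $y$ has both endpoints in the subtree $\overline{N}(v)$ of $\overline{N}$ rooted at $v$.
   Context: A network is a finite directed acyclic graph with a unique node of in-degree $0$ (the root); subdivision nodes (in- and out-degree $1$) are allowed. An underlying cycle is a cycle of the underlying undirected (multi)graph; two are distinct if they use different edge sets. A network is a galled tree if no two distinct underlying cycles share a node. A tree is a network with no underlying cycle. An LGT network is a network $N=(V,E_S\cup E_T)$ with a specified partition of its edges into support edges $E_S$ and transfer edges $E_T$ such that $(V,E_S)$ is a tree $\overline{N}$ (the support tree) on all of $V$, both endpoints of every transfer edge are incomparable in $\overline{N}$ (neither is an ancestor of the other), and every endpoint of a transfer edge (a transfer node) has exactly one child in $\overline{N}$. A galled LGT network is an LGT network that is a galled tree. Descendants are taken reflexively ($v$ is a descendant of itself). -}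

module Defs where

open import Data.Nat using (ℕ; suc)
open import Data.Nat.DivMod using (_%_; m%n<n)
open import Data.Fin using (Fin; toℕ; fromℕ<)
open import Data.Bool using (Bool; true; false)
open import Data.Product using (Σ; ∃; _×_; _,_)
open import Data.Sum using (_⊎_)
open import Data.Empty using (⊥)
open import Relation.Nullary using (¬_)
open import Relation.Binary.PropositionalEquality using (_≡_; _≢_)
open import Relation.Binary.Construct.Closure.ReflexiveTransitive using (Star)
open import Function.Definitions using (Injective)
open import Function.Bundles using (_⇔_)

next : ∀ {k} → Fin (suc k) → Fin (suc k)
next {k} i = fromℕ< (m%n<n (suc (toℕ i)) (suc k))

-- Generic finite directed multigraphs: nodes Fin n, edges of type E
-- (in our uses E is finite), edge e goes from src e to tgt e.

module _ {n : ℕ} {E : Set} (src tgt : E → Fin n) where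

  Arc : Fin n → Fin n → Set
  Arc u w = ∃ λ e → src e ≡ u × tgt e ≡ w

  Reach : Fin n → Fin n → Set
  Reach = Star Arc

  IsDAG : Set
  IsDAG = ∀ e → ¬ Reach (tgt e) (src e)

  InDeg0 : Fin n → Set
  InDeg0 v = ∀ e → tgt e ≢ v

  HasUniqueRoot : Set
  HasUniqueRoot = ∃ λ r → InDeg0 r × (∀ v → InDeg0 v → v ≡ r)

  IsNetwork : Set
  IsNetwork = IsDAG × HasUniqueRoot

  Joins : E → Fin n → Fin n → Set
  Joins e u w = (src e ≡ u × tgt e ≡ w) ⊎ (src e ≡ w × tgt e ≡ u)

  record Cycle : Set where
    field
      len   : ℕ
      nodes : Fin (suc len) → Fin n
      edges : Fin (suc len) → E
      nodes-inj : Injective _≡_ _≡_ nodes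
      edges-inj : Injective _≡_ _≡_ edges
      joins : ∀ i → Joins (edges i) (nodes i) (nodes (next i))

  OnCycle : Cycle → Fin n → Set
  OnCycle C v = ∃ λ i → Cycle.nodes C i ≡ v

  EdgeOfCycle : Cycle → E → Set
  EdgeOfCycle C e = ∃ λ i → Cycle.edges C i ≡ e

  SameCycle : Cycle → Cycle → Set
  SameCycle C D = ∀ e → EdgeOfCycle C e ⇔ EdgeOfCycle D e

  IsGalledTree : Set
  IsGalledTree = IsNetwork × (∀ C D v → OnCycle C v → OnCycle D v → SameCycle C D)

  IsTree : Set
  IsTree = IsNetwork × (Cycle → ⊥)

-- LGT networks: edges Fin m, transfer e ≡ true marks transfer edges,
-- the other edges are support edges.

module LGT {n m : ℕ} (src tgt : Fin m → Fin n) (transfer : Fin m → Bool) where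

  SuppEdge : Set
  SuppEdge = Σ (Fin m) (λ e → transfer e ≡ false)

  srcS tgtS : SuppEdge → Fin n
  srcS (e , _) = src e
  tgtS (e , _) = tgt e

  AncS : Fin n → Fin n → Set
  AncS = Reach srcS tgtS

  Incomparable : Fin n → Fin n → Set
  Incomparable u w = ¬ AncS u w × ¬ AncS w u

  IncidentTransfer : Fin m → Fin n → Set
  IncidentTransfer e v = transfer e ≡ true × (src e ≡ v ⊎ tgt e ≡ v)

  TransferNode : Fin n → Set
  TransferNode v = ∃ λ e → IncidentTransfer e v

  ExactlyOneSuppChild : Fin n → Set
  ExactlyOneSuppChild v =
    ∃ λ c → Arc srcS tgtS v c × (∀ c′ → Arc srcS tgtS v c′ → c′ ≡ c)

  IsLGT : Set
  IsLGT = IsNetwork src tgt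
        × IsTree srcS tgtS
        × (∀ e → transfer e ≡ true → Incomparable (src e) (tgt e))
        × (∀ v → TransferNode v → ExactlyOneSuppChild v)

  IsGalledLGT : Set
  IsGalledLGT = IsLGT × IsGalledTree src tgt

-- Let e be a transfer edge at x with other endpoint x′. If x′ lies below v in the support tree, e is
-- the edge sought; likewise at y. Otherwise e closes an underlying cycle through v: the support
-- paths from the root through v to x and from the root to x′, cut at their last common node, joined
-- by e. Acyclicity of the support tree makes it simple, and e is its only transfer edge. If this
-- happens at both x and y, the two cycles share v, so in a galled tree they have the same edges;
-- hence the two transfer edges coincide, forcing y ∈ {x, x′}, which is impossible.
-- The case split is decidable: two support parents of a node would also close a cycle, so parents
-- are unique and every support ancestor of w lies on the root path of w.
module Submission where

open import Defs
open import Data.Nat using (ℕ; zero; suc; s≤s)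
open import Data.Nat.Properties using (n<1+n)
open import Data.Nat.DivMod using (_%_; m<n⇒m%n≡m; n%n≡0)
open import Data.Fin using (Fin; zero; suc; fromℕ; inject₁)
open import Data.Fin.Properties using (toℕ-injective; toℕ-fromℕ<; toℕ-fromℕ; toℕ-inject₁; toℕ<n; _≟_; any?; <⇒notInjective)
open import Data.Unit using (⊤; tt)
open import Data.Bool using (Bool; true; false)
import Data.Bool.Properties as Bool
open import Data.Product using (Σ; ∃; _×_; _,_; proj₁; proj₂; map₂)
open import Data.Sum using (_⊎_; inj₁; inj₂)
open import Data.Empty using (⊥; ⊥-elim)
open import Data.List using (List; []; _∷_; _++_; length; lookup)
open import Data.List.Relation.Unary.All using (All; []; _∷_)
import Data.List.Relation.Unary.All as All
import Data.List.Relation.Unary.All.Properties as All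
open import Data.List.Relation.Unary.Any using (Any; here; there)
import Data.List.Relation.Unary.Any as Any
import Data.List.Relation.Unary.Any.Properties as Any
open import Data.List.Relation.Unary.Any.Properties using (lookup-index)
open import Data.List.Relation.Unary.AllPairs using (AllPairs; []; _∷_)
import Data.List.Relation.Unary.AllPairs.Properties as AllPairs
open import Data.List.Membership.Propositional using (_∈_; _∉_)
import Data.List.Membership.DecPropositional as DecMembership
open import Data.List.Membership.Propositional.Properties using (∈-lookup)
open import Relation.Nullary using (¬_; Dec; yes; no)
open import Relation.Nullary.Decidable using (_×-dec_)
open import Relation.Binary.Construct.Closure.ReflexiveTransitive using (ε; _◅_; _◅◅_)
open import Relation.Binary.PropositionalEquality using (_≡_; _≢_; ≢-sym; refl; sym; trans; cong; subst)
open import Function.Base using (_on_; _∘_; id)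
open import Function.Definitions using (Injective)
open import Function.Bundles using (_⇔_; mk⇔; Equivalence)

inject₁-or-fromℕ : ∀ {k} (i : Fin (suc k)) → (∃ λ j → i ≡ inject₁ j) ⊎ i ≡ fromℕ k
inject₁-or-fromℕ {zero}  zero    = inj₂ refl
inject₁-or-fromℕ {suc k} zero    = inj₁ (zero , refl)
inject₁-or-fromℕ {suc k} (suc i) with inject₁-or-fromℕ i
... | inj₁ (j , refl) = inj₁ (suc j , refl)
... | inj₂ refl       = inj₂ refl

next-inject₁ : ∀ {k} (j : Fin k) → next (inject₁ j) ≡ suc j
next-inject₁ {k} j = toℕ-injective (trans (toℕ-fromℕ< _)
  (trans (cong (λ z → suc z % suc k) (toℕ-inject₁ j)) (m<n⇒m%n≡m (s≤s (toℕ<n j)))))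

next-fromℕ : ∀ k → next (fromℕ k) ≡ zero
next-fromℕ k = toℕ-injective (trans (toℕ-fromℕ< _)
  (trans (cong (λ z → suc z % suc k) (toℕ-fromℕ k)) (n%n≡0 (suc k))))

lookup-injective : ∀ {A B : Set} (f : A → B) {xs : List A} →
                   AllPairs (_≢_ on f) xs → Injective _≡_ _≡_ (f ∘ lookup xs)
lookup-injective f (_  ∷ _)  {zero}  {zero}  _  = refl
lookup-injective f (fx ∷ _)  {zero}  {suc j} eq = ⊥-elim (All.lookup fx (∈-lookup j) eq)
lookup-injective f (fx ∷ _)  {suc i} {zero}  eq = ⊥-elim (All.lookup fx (∈-lookup i) (sym eq))
lookup-injective f (_  ∷ ap) {suc i} {suc j} eq = cong suc (lookup-injective f ap eq)

distinct-nodes⇒distinct-edges : ∀ {A B : Set} (h : B → A) {ps : List (A × B)} →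
  All (λ (a , b) → h b ≡ a) ps → AllPairs (_≢_ on proj₁) ps → AllPairs (_≢_ on proj₂) ps
distinct-nodes⇒distinct-edges h []         []       = []
distinct-nodes⇒distinct-edges h (hp ∷ hps) (d ∷ ds) =
  All.zipWith (λ (hq , dq) eq → dq (trans (sym hp) (trans (cong h eq) hq))) (hps , d)
  ∷ distinct-nodes⇒distinct-edges h hps ds

module _ {n : ℕ} {E : Set} (src tgt : E → Fin n) where

  incident⇒Joins : ∀ {e x} → src e ≡ x ⊎ tgt e ≡ x → ∃ λ x′ → Joins src tgt e x x′
  incident⇒Joins (inj₁ refl) = _ , inj₁ (refl , refl)
  incident⇒Joins (inj₂ refl) = _ , inj₂ (refl , refl)

  Joins-incident : ∀ {e x x′ z} → Joins src tgt e x x′ → src e ≡ z ⊎ tgt e ≡ z → z ≡ x ⊎ z ≡ x′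
  Joins-incident (inj₁ (refl , refl)) (inj₁ refl) = inj₁ refl
  Joins-incident (inj₁ (refl , refl)) (inj₂ refl) = inj₂ refl
  Joins-incident (inj₂ (refl , refl)) (inj₁ refl) = inj₂ refl
  Joins-incident (inj₂ (refl , refl)) (inj₂ refl) = inj₁ refl

  Joins-endpoints : ∀ {e x x′} (P : Fin n → Set) → Joins src tgt e x x′ → P x → P x′ → P (src e) × P (tgt e)
  Joins-endpoints P (inj₁ (refl , refl)) px px′ = px , px′
  Joins-endpoints P (inj₂ (refl , refl)) px px′ = px′ , px

module Walks {n : ℕ} {E : Set} (src tgt : E → Fin n) where

  Step : Set
  Step = Fin n × E

  -- Each step records the node it leaves and the edge it traverses, in either direction.
  data Walk : Fin n → Fin n → List Step → Set where
    []  : ∀ {u} → Walk u u []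
    _∷_ : ∀ {u v w e ps} → Joins src tgt e u v → Walk v w ps → Walk u w ((u , e) ∷ ps)

  _++ʷ_ : ∀ {u v w ps qs} → Walk u v ps → Walk v w qs → Walk u w (ps ++ qs)
  []      ++ʷ q = q
  (j ∷ p) ++ʷ q = j ∷ (p ++ʷ q)

  private
    -- the node where step i of a walk with steps p ∷ ps ending in w arrives
    reached : Fin n → (p : Step) (ps : List Step) → Fin (suc (length ps)) → Fin n
    reached w p []       zero    = w
    reached w p (q ∷ ps) zero    = proj₁ q
    reached w p (q ∷ ps) (suc i) = reached w q ps i

    reached-inject₁ : ∀ w p ps (j : Fin (length ps)) → reached w p ps (inject₁ j) ≡ proj₁ (lookup ps j)
    reached-inject₁ w p (q ∷ ps) zero    = refl
    reached-inject₁ w p (q ∷ ps) (suc j) = reached-inject₁ w q ps j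

    reached-fromℕ : ∀ w p ps → reached w p ps (fromℕ (length ps)) ≡ w
    reached-fromℕ w p []       = refl
    reached-fromℕ w p (q ∷ ps) = reached-fromℕ w q ps

    walk-joins : ∀ {u w p ps} → Walk u w (p ∷ ps) → ∀ i →
                 Joins src tgt (proj₂ (lookup (p ∷ ps) i)) (proj₁ (lookup (p ∷ ps) i)) (reached w p ps i)
    walk-joins (j ∷ [])      zero    = j
    walk-joins (j ∷ (_ ∷ _)) zero    = j
    walk-joins (_ ∷ W@(_ ∷ _)) (suc i) = walk-joins W i

    reached-next : ∀ {u p ps} → Walk u u (p ∷ ps) → ∀ i → reached u p ps i ≡ proj₁ (lookup (p ∷ ps) (next i))
    reached-next {u} {p} {ps} (_ ∷ _) i with inject₁-or-fromℕ i
    ... | inj₁ (j , refl) = trans (reached-inject₁ u p ps j) (cong (proj₁ ∘ lookup (p ∷ ps)) (sym (next-inject₁ j)))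
    ... | inj₂ refl       = trans (reached-fromℕ u p ps) (cong (proj₁ ∘ lookup (p ∷ ps)) (sym (next-fromℕ (length ps))))

  module ClosedWalk {u : Fin n} {p : Step} {ps : List Step} (W : Walk u u (p ∷ ps))
                    (distinct-nodes : AllPairs (_≢_ on proj₁) (p ∷ ps))
                    (distinct-edges : AllPairs (_≢_ on proj₂) (p ∷ ps)) where

    cycle : Cycle src tgt
    cycle = record
      { len       = length ps
      ; nodes     = λ i → proj₁ (lookup (p ∷ ps) i)
      ; edges     = λ i → proj₂ (lookup (p ∷ ps) i)
      ; nodes-inj = lookup-injective proj₁ distinct-nodes
      ; edges-inj = lookup-injective proj₂ distinct-edges
      ; joins     = λ i → subst (Joins src tgt _ _) (reached-next W i) (walk-joins W i)
      }

    step-on-cycle : ∀ {w} → Any (λ s → proj₁ s ≡ w) (p ∷ ps) → OnCycle src tgt cycle w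
    step-on-cycle k = Any.index k , lookup-index k

    edge-of-cycle : ∀ {e} → EdgeOfCycle src tgt cycle e ⇔ Any (λ s → proj₂ s ≡ e) (p ∷ ps)
    edge-of-cycle = mk⇔ (λ { (i , refl) → Any.map (λ eq → cong proj₂ (sym eq)) (∈-lookup i) })
                        (λ k → Any.index k , lookup-index k)

module DirectedPaths {n : ℕ} {E : Set} (src tgt : E → Fin n) where

  Path : Fin n → Fin n → Set
  Path = Reach src tgt

  nodes : ∀ {a b} → Path a b → List (Fin n)
  nodes {a} ε       = a ∷ []
  nodes {a} (_ ◅ p) = a ∷ nodes p

  tailNodes : ∀ {a b} → Path a b → List (Fin n)
  tailNodes ε       = []
  tailNodes (_ ◅ p) = nodes p

  source∈nodes : ∀ {a b} (p : Path a b) → a ∈ nodes p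
  source∈nodes ε       = here refl
  source∈nodes (_ ◅ _) = here refl

  target∈nodes : ∀ {a b} (p : Path a b) → b ∈ nodes p
  target∈nodes ε       = here refl
  target∈nodes (_ ◅ p) = there (target∈nodes p)

  ∈nodes⇒source⊎∈tailNodes : ∀ {a b w} (p : Path a b) → w ∈ nodes p → w ≡ a ⊎ w ∈ tailNodes p
  ∈nodes⇒source⊎∈tailNodes ε       (here eq) = inj₁ eq
  ∈nodes⇒source⊎∈tailNodes (_ ◅ _) (here eq) = inj₁ eq
  ∈nodes⇒source⊎∈tailNodes (_ ◅ _) (there m) = inj₂ m

  ∈nodes-◅◅ʳ : ∀ {a b c w} (p : Path a b) (q : Path b c) → w ∈ nodes q → w ∈ nodes (p ◅◅ q)
  ∈nodes-◅◅ʳ ε       q m = m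
  ∈nodes-◅◅ʳ (_ ◅ p) q m = there (∈nodes-◅◅ʳ p q m)

  prefix : ∀ {a b w} (p : Path a b) → w ∈ nodes p → Path a w
  prefix ε       (here refl) = ε
  prefix (_ ◅ _) (here refl) = ε
  prefix (x ◅ p) (there m)   = x ◅ prefix p m

  suffix : ∀ {a b w} (p : Path a b) → w ∈ nodes p → Path w b
  suffix ε       (here refl) = ε
  suffix (x ◅ p) (here refl) = x ◅ p
  suffix (_ ◅ p) (there m)   = suffix p m

  suffix-⊆ : ∀ {a b w v} (p : Path a b) (m : w ∈ nodes p) → v ∈ nodes (suffix p m) → v ∈ nodes p
  suffix-⊆ ε       (here refl) k = k
  suffix-⊆ (_ ◅ _) (here refl) k = k
  suffix-⊆ (_ ◅ p) (there m)   k = there (suffix-⊆ p m k)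

  ∈suffix⊎reaches : ∀ {a b w v} (p : Path a b) (m : w ∈ nodes p) → v ∈ nodes p → v ∈ nodes (suffix p m) ⊎ Path v w
  ∈suffix⊎reaches ε       (here refl) k         = inj₁ k
  ∈suffix⊎reaches (_ ◅ _) (here refl) k         = inj₁ k
  ∈suffix⊎reaches (x ◅ p) (there m)   (here refl) = inj₂ (x ◅ prefix p m)
  ∈suffix⊎reaches (_ ◅ p) (there m)   (there k) = ∈suffix⊎reaches p m k

  open DecMembership (_≟_ {n}) using (_∈?_)

  lastVisit : ∀ (qs : List (Fin n)) {a b} (p : Path a b) →
    (∀ {w} → w ∈ nodes p → w ∉ qs) ⊎
    (∃ λ c → Σ (c ∈ nodes p) λ m → c ∈ qs × All (_∉ qs) (tailNodes (suffix p m)))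
  lastVisit qs {a} ε with a ∈? qs
  ... | yes a∈ = inj₂ (a , here refl , a∈ , [])
  ... | no  a∉ = inj₁ λ { (here refl) → a∉ }
  lastVisit qs {a} (x ◅ p) with lastVisit qs p
  ... | inj₂ (c , m , c∈ , avoids) = inj₂ (c , there m , c∈ , avoids)
  ... | inj₁ avoid with a ∈? qs
  ...   | yes a∈ = inj₂ (a , here refl , a∈ , All.tabulate avoid)
  ...   | no  a∉ = inj₁ λ { (here refl) → a∉ ; (there m) → avoid m }

module Forks {n : ℕ} {EH E : Set} (src tgt : E → Fin n) (ι : EH → E)
            (acyclic : IsDAG (src ∘ ι) (tgt ∘ ι)) (Allowed : E → Set) where

  open Walks src tgt
  open DirectedPaths (src ∘ ι) (tgt ∘ ι)

  NoReturn : E → Set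
  NoReturn e = ¬ Path (tgt e) (src e)

  AllAllowed : ∀ {a b} → Path a b → Set
  AllAllowed ε             = ⊤
  AllAllowed ((g , _) ◅ p) = Allowed (ι g) × AllAllowed p

  AllAllowed-◅◅ : ∀ {a b c} (p : Path a b) (q : Path b c) → AllAllowed p → AllAllowed q → AllAllowed (p ◅◅ q)
  AllAllowed-◅◅ ε       q _          okq = okq
  AllAllowed-◅◅ (_ ◅ p) q (ok , okp) okq = ok , AllAllowed-◅◅ p q okp okq

  AllAllowed-by : ∀ {a b} (p : Path a b) → (∀ g → Path (tgt (ι g)) b → Allowed (ι g)) → AllAllowed p
  AllAllowed-by ε                   _  = tt
  AllAllowed-by ((g , _ , refl) ◅ p) ok = ok g p , AllAllowed-by p ok

  AllAllowed-suffix : ∀ {a b w} (p : Path a b) (m : w ∈ nodes p) → AllAllowed p → AllAllowed (suffix p m)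
  AllAllowed-suffix ε       (here refl) ok       = ok
  AllAllowed-suffix (_ ◅ _) (here refl) ok       = ok
  AllAllowed-suffix (_ ◅ p) (there m)   (_ , ok) = AllAllowed-suffix p m ok

  forwardSteps : ∀ {a b} → Path a b → List Step
  forwardSteps     ε             = []
  forwardSteps {a} ((g , _) ◅ p) = (a , ι g) ∷ forwardSteps p

  forwardWalk : ∀ {a b} (p : Path a b) → Walk a b (forwardSteps p)
  forwardWalk ε                       = []
  forwardWalk ((g , refl , refl) ◅ p) = inj₁ (refl , refl) ∷ forwardWalk p

  backwardSteps : ∀ {a b} → Path a b → List Step
  backwardSteps ε                       = []
  backwardSteps (_◅_ {j = b} (g , _) p) = backwardSteps p ++ (b , ι g) ∷ []

  backwardWalk : ∀ {a b} (p : Path a b) → Walk b a (backwardSteps p)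
  backwardWalk ε                       = []
  backwardWalk ((g , refl , refl) ◅ p) = backwardWalk p ++ʷ (inj₂ (refl , refl) ∷ [])

  ForwardStep : ∀ {a b} → Path a b → Step → Set
  ForwardStep {b = b} p (w , e) = src e ≡ w × Path (tgt e) b × NoReturn e × w ∈ nodes p × tgt e ∈ tailNodes p

  forwardSteps-valid : ∀ {a b} (p : Path a b) → All (ForwardStep p) (forwardSteps p)
  forwardSteps-valid ε                       = []
  forwardSteps-valid ((g , refl , refl) ◅ p) =
    (refl , p , acyclic g , here refl , source∈nodes p)
    ∷ All.map (λ (s , r , nr , w∈ , t∈) → s , r , nr , there w∈ , tailNodes⊆nodes p t∈) (forwardSteps-valid p)
    where
    tailNodes⊆nodes : ∀ {a b v} (p : Path a b) → v ∈ tailNodes p → v ∈ nodes p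
    tailNodes⊆nodes (_ ◅ _) m = there m

  forwardSteps-distinct : ∀ {a b} (p : Path a b) → AllPairs (_≢_ on proj₁) (forwardSteps p)
  forwardSteps-distinct ε                       = []
  forwardSteps-distinct ((g , refl , refl) ◅ p) =
    All.map (λ (_ , _ , _ , w∈ , _) a≡w → acyclic g (subst (Path _) (sym a≡w) (prefix p w∈))) (forwardSteps-valid p)
    ∷ forwardSteps-distinct p

  forwardSteps-allowed : ∀ {a b} (p : Path a b) → AllAllowed p → All (Allowed ∘ proj₂) (forwardSteps p)
  forwardSteps-allowed ε             _          = []
  forwardSteps-allowed ((g , _) ◅ p) (ok , okp) = ok ∷ forwardSteps-allowed p okp

  forwardSteps-cover : ∀ {a b w} (p : Path a b) → w ∈ nodes p → Any (λ s → proj₁ s ≡ w) (forwardSteps p) ⊎ w ≡ b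
  forwardSteps-cover ε                       (here refl) = inj₂ refl
  forwardSteps-cover ((g , refl , refl) ◅ p) (here refl) = inj₁ (here refl)
  forwardSteps-cover ((g , refl , refl) ◅ p) (there m)   with forwardSteps-cover p m
  ... | inj₁ k = inj₁ (there k)
  ... | inj₂ e = inj₂ e

  BackwardStep : ∀ {a b} → Path a b → Step → Set
  BackwardStep {a} p (w , e) = tgt e ≡ w × Path a (src e) × NoReturn e × w ∈ nodes p

  backwardSteps-valid : ∀ {a b} (p : Path a b) → All (BackwardStep p) (backwardSteps p)
  backwardSteps-valid ε                         = []
  backwardSteps-valid (x@(g , refl , refl) ◅ p) =
    All.++⁺ (All.map (λ (t , r , nr , w∈) → t , x ◅ r , nr , there w∈) (backwardSteps-valid p))
            ((refl , ε , acyclic g , there (source∈nodes p)) ∷ [])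

  backwardSteps-distinct : ∀ {a b} (p : Path a b) → AllPairs (_≢_ on proj₁) (backwardSteps p)
  backwardSteps-distinct ε                       = []
  backwardSteps-distinct ((g , refl , refl) ◅ p) =
    AllPairs.++⁺ (backwardSteps-distinct p) ([] ∷ [])
      (All.map (λ (t , r , nr , _) → (λ w≡b → nr (subst (λ z → Path z _) (sym (trans t w≡b)) r)) ∷ [])
               (backwardSteps-valid p))

  backwardSteps-allowed : ∀ {a b} (p : Path a b) → AllAllowed p → All (Allowed ∘ proj₂) (backwardSteps p)
  backwardSteps-allowed ε             _          = []
  backwardSteps-allowed ((g , _) ◅ p) (ok , okp) = All.++⁺ (backwardSteps-allowed p okp) (ok ∷ [])

  -- The cycle closes f with the parts of p and q after the last node c of p that lies on q.
  fork⇒Cycle : ∀ {a u₁ u₂} (p : Path a u₁) (q : Path a u₂) (f : E) →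
    Joins src tgt f u₁ u₂ → ¬ Allowed f → AllAllowed p → AllAllowed q →
    Σ (Cycle src tgt) λ C → EdgeOfCycle src tgt C f
                          × (∀ {e} → EdgeOfCycle src tgt C e → e ≡ f ⊎ Allowed e)
                          × (∀ {w} → w ∈ nodes p → (∀ {z} → z ∈ nodes q → ¬ Path w z) → OnCycle src tgt C w)
  fork⇒Cycle {u₁ = u₁} {u₂} p q f f-joins f-forbidden allowed-p allowed-q with lastVisit (nodes q) p
  ... | inj₁ avoid = ⊥-elim (avoid (source∈nodes p) (source∈nodes q))
  ... | inj₂ (c , c∈p , c∈q , avoids) = cycle , Equivalence.from edge-of-cycle (here refl) , edge-kind , on-p
    where
    p₂ : Path c u₁
    p₂ = suffix p c∈p
    q₂ : Path c u₂
    q₂ = suffix q c∈q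
    steps : List Step
    steps = backwardSteps q₂ ++ forwardSteps p₂
    bwd-valid : All (BackwardStep q₂) (backwardSteps q₂)
    bwd-valid = backwardSteps-valid q₂
    fwd-valid : All (ForwardStep p₂) (forwardSteps p₂)
    fwd-valid = forwardSteps-valid p₂
    steps-allowed : All (Allowed ∘ proj₂) steps
    steps-allowed = All.++⁺ (backwardSteps-allowed q₂ (AllAllowed-suffix q c∈q allowed-q)) (forwardSteps-allowed p₂ (AllAllowed-suffix p c∈p allowed-p))

    start⊎avoids : ∀ {v} → v ∈ nodes p₂ → v ≡ c ⊎ v ∉ nodes q
    start⊎avoids v∈ with ∈nodes⇒source⊎∈tailNodes p₂ v∈
    ... | inj₁ v≡c = inj₁ v≡c
    ... | inj₂ v∈t = inj₂ (All.lookup avoids v∈t)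

    backward≢p₂ : ∀ {s v} → BackwardStep q₂ s → v ∈ nodes p₂ → proj₁ s ≢ v
    backward≢p₂ (t , r , nr , w∈) v∈ w≡v with start⊎avoids v∈
    ... | inj₁ v≡c = nr (subst (λ z → Path z _) (sym (trans t (trans w≡v v≡c))) r)
    ... | inj₂ v∉  = v∉ (subst (_∈ nodes q) w≡v (suffix-⊆ q c∈q w∈))

    backward≢forward-edge : ∀ {s s′} → BackwardStep q₂ s → ForwardStep p₂ s′ → proj₂ s ≢ proj₂ s′
    backward≢forward-edge (t , _ , _ , w∈) (_ , _ , _ , _ , t′∈) e≡e′ =
      All.lookup avoids t′∈ (subst (_∈ nodes q) (trans (sym t) (cong tgt e≡e′)) (suffix-⊆ q c∈q w∈))

    distinct-nodes : AllPairs (_≢_ on proj₁) ((u₁ , f) ∷ steps)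
    distinct-nodes =
      All.++⁺ (All.map (λ s → ≢-sym (backward≢p₂ s (target∈nodes p₂))) bwd-valid)
              (All.map (λ (w≡ , r , nr , _) u₁≡w → nr (subst (Path _) (trans u₁≡w (sym w≡)) r)) fwd-valid)
      ∷ AllPairs.++⁺ (backwardSteps-distinct q₂) (forwardSteps-distinct p₂)
                     (All.map (λ s → All.map (λ (_ , _ , _ , v∈ , _) → backward≢p₂ s v∈) fwd-valid) bwd-valid)

    distinct-edges : AllPairs (_≢_ on proj₂) ((u₁ , f) ∷ steps)
    distinct-edges =
      All.map (λ ok f≡e → f-forbidden (subst Allowed (sym f≡e) ok)) steps-allowed
      ∷ AllPairs.++⁺ (distinct-nodes⇒distinct-edges tgt (All.map proj₁ bwd-valid) (backwardSteps-distinct q₂))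
                     (distinct-nodes⇒distinct-edges src (All.map proj₁ fwd-valid) (forwardSteps-distinct p₂))
                     (All.map (λ s → All.map (backward≢forward-edge s) fwd-valid) bwd-valid)

    walk : Walk u₁ u₁ ((u₁ , f) ∷ steps)
    walk = f-joins ∷ (backwardWalk q₂ ++ʷ forwardWalk p₂)

    open ClosedWalk walk distinct-nodes distinct-edges

    edge-kind : ∀ {e} → EdgeOfCycle src tgt cycle e → e ≡ f ⊎ Allowed e
    edge-kind e∈ with Equivalence.to edge-of-cycle e∈
    ... | here f≡e = inj₁ (sym f≡e)
    ... | there k  = inj₂ (All.lookupWith (λ ok eq → subst Allowed eq ok) steps-allowed k)

    on-p : ∀ {w} → w ∈ nodes p → (∀ {z} → z ∈ nodes q → ¬ Path w z) → OnCycle src tgt cycle w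
    on-p w∈ below-q with ∈suffix⊎reaches p c∈p w∈
    ... | inj₂ w⇝c = ⊥-elim (below-q c∈q w⇝c)
    ... | inj₁ w∈p₂ with forwardSteps-cover p₂ w∈p₂
    ...   | inj₁ k    = step-on-cycle (there (Any.++⁺ʳ (backwardSteps q₂) k))
    ...   | inj₂ w≡u₁ = step-on-cycle (here (sym w≡u₁))

module Networks {n : ℕ} {E : Set} (src tgt : E → Fin n) (network : IsNetwork src tgt)
                (parent? : ∀ v → (∃ λ e → tgt e ≡ v) ⊎ InDeg0 src tgt v) where

  open DirectedPaths src tgt using (Path)

  root : Fin n
  root = proj₁ (proj₂ network)

  root-source : InDeg0 src tgt root
  root-source = proj₁ (proj₂ (proj₂ network))

  private
    acyclic : IsDAG src tgt
    acyclic = proj₁ network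
    root-unique : ∀ v → InDeg0 src tgt v → v ≡ root
    root-unique = proj₂ (proj₂ (proj₂ network))

    -- Pigeonhole: climbing k parent edges from w either reaches the root or exhibits k + 1 distinct nodes.
    climb : ∀ k w → Path root w ⊎ ∃ λ u → Path u w × Σ (Fin (suc k) → Fin n) λ d → Injective _≡_ _≡_ d × ∀ i → Path u (d i)
    climb zero    w = inj₂ (w , ε , (λ _ → w) , (λ { {zero} {zero} _ → refl }) , λ _ → ε)
    climb (suc k) w with climb k w
    ... | inj₁ root⇝w = inj₁ root⇝w
    ... | inj₂ (u , u⇝w , d , d-inj , u⇝d) with parent? u
    ...   | inj₂ u-source = inj₁ (subst (λ z → Path z w) (root-unique u u-source) u⇝w)
    ...   | inj₁ (e , refl) = inj₂ (src e , arc ◅ u⇝w , d′ , d′-inj , s⇝d′)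
      where
      arc : Arc src tgt (src e) (tgt e)
      arc = e , refl , refl
      d′ : Fin (suc (suc k)) → Fin n
      d′ zero    = src e
      d′ (suc i) = d i
      src≢d : ∀ i → src e ≢ d i
      src≢d i eq = acyclic e (subst (Path (tgt e)) (sym eq) (u⇝d i))
      d′-inj : Injective _≡_ _≡_ d′
      d′-inj {zero}  {zero}  _  = refl
      d′-inj {zero}  {suc j} eq = ⊥-elim (src≢d j eq)
      d′-inj {suc i} {zero}  eq = ⊥-elim (src≢d i (sym eq))
      d′-inj {suc i} {suc j} eq = cong suc (d-inj eq)
      s⇝d′ : ∀ i → Path (src e) (d′ i)
      s⇝d′ zero    = ε
      s⇝d′ (suc i) = arc ◅ u⇝d i

  root-reaches : ∀ w → Path root w
  root-reaches w with climb n w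
  ... | inj₁ root⇝w              = root⇝w
  ... | inj₂ (_ , _ , _ , d-inj , _) = ⊥-elim (<⇒notInjective (n<1+n n) d-inj)

module Trees {n : ℕ} {E : Set} (src tgt : E → Fin n) (tree : IsTree src tgt)
             (parent? : ∀ v → (∃ λ e → tgt e ≡ v) ⊎ InDeg0 src tgt v) where

  open DirectedPaths src tgt
  open Networks src tgt (proj₁ tree) parent? public

  private
    acyclic : IsDAG src tgt
    acyclic = proj₁ (proj₁ tree)
    no-cycle : Cycle src tgt → ⊥
    no-cycle = proj₂ tree

  -- Two parents of one node would close a cycle with their root paths.
  parent-unique : ∀ e₁ e₂ → tgt e₁ ≡ tgt e₂ → src e₁ ≡ src e₂
  parent-unique e₁ e₂ t≡ with src e₁ ≟ src e₂
  ... | yes s≡ = s≡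
  ... | no  s≢ = ⊥-elim (no-cycle (proj₁ (fork⇒Cycle p₁ p₂ e₁ (inj₁ (refl , t≡)) (λ e₁≢e₁ → e₁≢e₁ refl) allowed₁ allowed₂)))
    where
    open Forks src tgt id acyclic (_≢ e₁) using (fork⇒Cycle; AllAllowed; AllAllowed-by; AllAllowed-◅◅)
    p₁ : Path root (src e₁)
    p₁ = root-reaches (src e₁)
    p₂ : Path root (tgt e₂)
    p₂ = root-reaches (src e₂) ◅◅ ((e₂ , refl , refl) ◅ ε)
    allowed₁ : AllAllowed p₁
    allowed₁ = AllAllowed-by p₁ λ g g⇝s₁ g≡e₁ → acyclic e₁ (subst (λ h → Path (tgt h) (src e₁)) g≡e₁ g⇝s₁)
    allowed₂ : AllAllowed p₂
    allowed₂ = AllAllowed-◅◅ (root-reaches (src e₂)) _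
      (AllAllowed-by _ λ g g⇝s₂ g≡e₁ → acyclic e₂ (subst (λ z → Path z (src e₂)) t≡ (subst (λ h → Path (tgt h) (src e₂)) g≡e₁ g⇝s₂)))
      ((λ e₂≡e₁ → s≢ (cong src (sym e₂≡e₁))) , tt)

  parent∈nodes : ∀ {s w a b} (p : Path s w) → b ∈ nodes p → Arc src tgt a b → a ∈ nodes p ⊎ b ≡ s
  parent∈nodes ε                       (here refl) _ = inj₂ refl
  parent∈nodes (_ ◅ _)                 (here refl) _ = inj₂ refl
  parent∈nodes ((e′ , refl , refl) ◅ p) (there b∈)  arc@(e , refl , t≡) with parent∈nodes p b∈ arc
  ... | inj₁ a∈  = inj₁ (there a∈)
  ... | inj₂ b≡  = inj₁ (here (parent-unique e e′ (trans t≡ b≡)))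

  ancestor∈rootPath : ∀ {a w} (p : Path root w) → Path a w → a ∈ nodes p
  ancestor∈rootPath p ε = target∈nodes p
  ancestor∈rootPath p (arc@(e , _ , t≡) ◅ a⇝w) with parent∈nodes p (ancestor∈rootPath p a⇝w) arc
  ... | inj₁ a∈     = a∈
  ... | inj₂ b≡root = ⊥-elim (root-source e (trans t≡ b≡root))

  open DecMembership (_≟_ {n}) using (_∈?_)

  Path? : ∀ a w → Dec (Path a w)
  Path? a w with a ∈? nodes (root-reaches w)
  ... | yes a∈ = yes (suffix (root-reaches w) a∈)
  ... | no  a∉ = no λ a⇝w → a∉ (ancestor∈rootPath (root-reaches w) a⇝w)

module GalledLGT {n m : ℕ} (src tgt : Fin m → Fin n) (transfer : Fin m → Bool)
                 (N : LGT.IsGalledLGT src tgt transfer) where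

  open LGT src tgt transfer

  private
    support-tree : IsTree srcS tgtS
    support-tree = proj₁ (proj₂ (proj₁ N))
    galled : ∀ C D v → OnCycle src tgt C v → OnCycle src tgt D v → SameCycle src tgt C D
    galled = proj₂ (proj₂ N)

    true≢false : true ≢ false
    true≢false ()

    support-parent? : ∀ v → (∃ λ (e : SuppEdge) → tgtS e ≡ v) ⊎ InDeg0 srcS tgtS v
    support-parent? v with any? (λ e → (transfer e Bool.≟ false) ×-dec (tgt e ≟ v))
    ... | yes (e , tf , t≡) = inj₁ ((e , tf) , t≡)
    ... | no  none          = inj₂ λ (e , tf) t≡ → none (e , tf , t≡)

  open DirectedPaths srcS tgtS
  open Trees srcS tgtS support-tree support-parent?

  TransferExit : Fin n → Fin m → Fin n → Set
  TransferExit v e x = transfer e ≡ true × AncS v x × ∃ λ x′ → Joins src tgt e x x′ × ¬ AncS v x′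

  -- The cycle runs from the root down through v to x, across e, and back up to the root.
  TransferExit⇒Cycle : ∀ {v e x} → TransferExit v e x →
    Σ (Cycle src tgt) λ C → EdgeOfCycle src tgt C e
                          × (∀ {e′} → EdgeOfCycle src tgt C e′ → e′ ≡ e ⊎ transfer e′ ≡ false)
                          × OnCycle src tgt C v
  TransferExit⇒Cycle {v} {e} {x} (te , v⇝x , x′ , e-joins , v⋬x′) =
    map₂ (map₂ (map₂ λ on-p → on-p v∈p v-above-q))
         (fork⇒Cycle p q e e-joins (λ tf → true≢false (trans (sym te) tf))
                     (AllAllowed-by p λ g _ → proj₂ g) (AllAllowed-by q λ g _ → proj₂ g))
    where
    open Forks src tgt proj₁ (proj₁ (proj₁ support-tree)) (λ e → transfer e ≡ false) using (fork⇒Cycle; AllAllowed-by)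
    p : AncS root x
    p = root-reaches v ◅◅ v⇝x
    q : AncS root x′
    q = root-reaches x′
    v∈p : v ∈ nodes p
    v∈p = ∈nodes-◅◅ʳ (root-reaches v) v⇝x (source∈nodes v⇝x)
    v-above-q : ∀ {z} → z ∈ nodes q → ¬ AncS v z
    v-above-q z∈ v⇝z = v⋬x′ (v⇝z ◅◅ suffix q z∈)

  -- Both cycles pass through v, so in a galled tree they have the same edges.
  TransferExit-unique : ∀ {v e x e′ x′} → TransferExit v e x → TransferExit v e′ x′ → e′ ≡ e
  TransferExit-unique exit exit′ with TransferExit⇒Cycle exit | TransferExit⇒Cycle exit′
  ... | C , _ , kinds , v∈C | C′ , e′∈C′ , _ , v∈C′ with kinds (Equivalence.to (galled C′ C _ v∈C′ v∈C _) e′∈C′)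
  ...   | inj₁ e′≡e      = e′≡e
  ...   | inj₂ t′≡false = ⊥-elim (true≢false (trans (sym (proj₁ exit′)) t′≡false))

  within⊎TransferExit : ∀ {v e x} → AncS v x → IncidentTransfer e x →
                        (AncS v (src e) × AncS v (tgt e)) ⊎ TransferExit v e x
  within⊎TransferExit {v} v⇝x (te , x∈e) with incident⇒Joins src tgt x∈e
  ... | x′ , e-joins with Path? v x′
  ...   | yes v⇝x′ = inj₁ (Joins-endpoints src tgt (AncS v) e-joins v⇝x v⇝x′)
  ...   | no  v⋬x′ = inj₂ (te , v⇝x , x′ , e-joins , v⋬x′)

  TransferExit-endpoint : ∀ {v e x y} → TransferExit v e x → IncidentTransfer e y → AncS v y → y ≡ x
  TransferExit-endpoint {v} (_ , _ , x′ , e-joins , v⋬x′) (_ , y∈e) v⇝y with Joins-incident src tgt e-joins y∈e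
  ... | inj₁ y≡x  = y≡x
  ... | inj₂ y≡x′ = ⊥-elim (v⋬x′ (subst (AncS v) y≡x′ v⇝y))

  transfer-edge-within-subtree : ∀ v x y → x ≢ y → AncS v x → AncS v y → TransferNode x → TransferNode y →
    ∃ λ e → (IncidentTransfer e x ⊎ IncidentTransfer e y) × AncS v (src e) × AncS v (tgt e)
  transfer-edge-within-subtree v x y x≢y v⇝x v⇝y (eˣ , x∈eˣ) (eʸ , y∈eʸ)
    with within⊎TransferExit v⇝x x∈eˣ | within⊎TransferExit v⇝y y∈eʸ
  ... | inj₁ within | _           = eˣ , inj₁ x∈eˣ , within
  ... | inj₂ _      | inj₁ within = eʸ , inj₂ y∈eʸ , within
  ... | inj₂ exitˣ  | inj₂ exitʸ  =
    ⊥-elim (x≢y (sym (TransferExit-endpoint exitˣ (subst (λ e → IncidentTransfer e y) (TransferExit-unique exitˣ exitʸ) y∈eʸ) v⇝y)))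

lemma2 : ∀ {n m : ℕ} (src tgt : Fin m → Fin n) (transfer : Fin m → Bool)
         → LGT.IsGalledLGT src tgt transfer
         → ∀ (v x y : Fin n) → x ≢ y
         → LGT.AncS src tgt transfer v x → LGT.AncS src tgt transfer v y
         → LGT.TransferNode src tgt transfer x → LGT.TransferNode src tgt transfer y
         → ∃ λ e → (LGT.IncidentTransfer src tgt transfer e x ⊎ LGT.IncidentTransfer src tgt transfer e y)
                   × LGT.AncS src tgt transfer v (src e) × LGT.AncS src tgt transfer v (tgt e)
lemma2 src tgt transfer N = GalledLGT.transfer-edge-within-subtree src tgt transfer N
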